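{- Let $\mathcal{L}$ be a first-order signature, $X$ a set of $\mathcal{L}$-Henkin sequents, and $S_1,S_2$ $\mathcal{L}$-Henkin sequents. Then $\mathrm{Th}(X\cup\{S_1\sqcup S_2\})=\mathrm{Th}(X\cup\{S_1\})\cap\mathrm{Th}(X\cup\{S_2\})$; that is, for every $\mathcal{L}$-Henkin sequent $S$, $X,S_1\sqcup S_2\vdash_{\mathcal{ST}^H}S$ if and only if both $X,S_1\vdash_{\mathcal{ST}^H}S$ and $X,S_2\vdash_{\mathcal{ST}^H}S$.
   Context: Signature $\mathcal{L}$: relation and function symbols of finite arity, at least one relation symbol; formulas built with $\neg,\wedge,\vee,\forall,\exists$; $\varphi[x\mapsto t]$ is capture-free substitution. The Henkin expansion $\mathrm{Hen}\,\mathcal{L}=\bigcup_i\mathcal{L}_i$, where $\mathcal{L}_0=\mathcal{L}$ and $\mathcal{L}_{i+1}$ adds to $\mathcal{L}_i$ a new constant $\mathsf{w}(\forall x\,\varphi)$ for each universal $\mathcal{L}_i$-formula $\forall x\,\varphi$ and $\mathsf{w}(\exists x\,\varphi)$ for each existential $\mathcal{L}_i$-formula $\exists x\,\varphi$; its formulas/terms are $\mathcal{L}$-Henkin formulas/terms. An $\mathcal{L}$-Henkin sequent $\Gamma\vartriangleright\Delta$ is a pair of finite sets of $\mathcal{L}$-Henkin formulas; $\varphi,\Gamma$ means $\{\varphi\}\cup\Gamma$. $(\Gamma_1\vartriangleright\Delta_1)\sqcup(\Gamma_2\vartriangleright\Delta_2):=\Gamma_1\cup\Gamma_2\vartriangleright\Delta_1\cup\Delta_2$.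 The calculus $\mathcal{ST}^H$ ($t$ ranges over $\mathcal{L}$-Henkin terms): axiom (ID) $\varphi\vartriangleright\varphi$; (WL), (WR) weakening on either side; bidirectional rules, usable top-down and bottom-up (from conclusion to any one premise), premises / conclusion: ($\wedge$L) $\varphi,\psi,\Gamma\vartriangleright\Delta$ / $\varphi\wedge\psi,\Gamma\vartriangleright\Delta$; ($\wedge$R) $\Gamma\vartriangleright\Delta,\varphi$ and $\Gamma\vartriangleright\Delta,\psi$ / $\Gamma\vartriangleright\Delta,\varphi\wedge\psi$; ($\vee$L) $\varphi,\Gamma\vartriangleright\Delta$ and $\psi,\Gamma\vartriangleright\Delta$ / $\varphi\vee\psi,\Gamma\vartriangleright\Delta$; ($\vee$R) $\Gamma\vartriangleright\Delta,\varphi,\psi$ / $\Gamma\vartriangleright\Delta,\varphi\vee\psi$; ($\neg$R) $\varphi,\Gamma\vartriangleright\Delta$ / $\Gamma\vartriangleright\Delta,\neg\varphi$; ($\neg$L) $\Gamma\vartriangleright\Delta,\varphi$ / $\neg\varphi,\Gamma\vartriangleright\Delta$; ($\forall$LW) $\varphi[x\mapsto\mathsf{w}(\forall x\,\varphi)],\Gamma\vartriangleright\Delta$ / $\forall x\,\varphi,\Gamma\vartriangleright\Delta$; ($\forall$RW) $\Gamma\vartriangleright\Delta,\varphi[x\mapsto\mathsf{w}(\forall x\,\varphi)]$ / $\Gamma\vartriangleright\Delta,\forall x\,\varphi$; ($\exists$LW), ($\exists$RW) analogously with $\mathsf{w}(\exists x\,\varphi)$ and $\exists x\,\varphi$. One-directional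 rules: (UWI) $\varphi[x\mapsto t],\Gamma\vartriangleright\Delta$ / $\varphi[x\mapsto\mathsf{w}(\forall x\,\varphi)],\Gamma\vartriangleright\Delta$; (EWI) $\Gamma\vartriangleright\Delta,\varphi[x\mapsto t]$ / $\Gamma\vartriangleright\Delta,\varphi[x\mapsto\mathsf{w}(\exists x\,\varphi)]$; (EWE) $\varphi[x\mapsto\mathsf{w}(\exists x\,\varphi)],\Gamma\vartriangleright\Delta$ / $\varphi[x\mapsto t],\Gamma\vartriangleright\Delta$; (UWE) $\Gamma\vartriangleright\Delta,\varphi[x\mapsto\mathsf{w}(\forall x\,\varphi)]$ / $\Gamma\vartriangleright\Delta,\varphi[x\mapsto t]$. No cut. $X\vdash_{\mathcal{ST}^H}S$: there is a finite derivation of $S$ whose leaves are (ID) instances or members of $X$; $X,S'$ denotes $X\cup\{S'\}$. $\mathrm{Th}(X)$ is the set of all $\mathcal{L}$-Henkin sequents $S$ with $X\vdash_{\mathcal{ST}^H}S$. -}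

module Defs where

open import Data.Nat using (ℕ; zero; suc; _+_; compare; less; equal; greater; _<ᵇ_)
open import Data.Bool using (if_then_else_)
open import Data.List using (List; []; _∷_; _++_)
open import Data.Vec using (Vec; []; _∷_)
open import Data.List.Relation.Binary.Subset.Propositional using (_⊆_)
open import Data.Product using (_×_)
open import Data.Sum using (_⊎_)
open import Relation.Binary.PropositionalEquality using (_≡_)

record Signature : Set₁ where
  field
    Rel      : Set
    Fun      : Set
    relArity : Rel → ℕ
    funArity : Fun → ℕ
    someRel  : Rel

-- L-Henkin terms and formulas (formulas/terms of Hen L = ⋃ L_i).
-- Variables are de Bruijn indices; `all φ` / `ex φ` bind index 0 in φ.
-- `wAll φ` is the Henkin constant w(∀x φ), `wEx φ` is w(∃x φ)
-- (indexed by the body φ of the quantified formula).  Every term/formula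
-- of this mutual inductive type has finite nesting depth of witnesses,
-- i.e. lies in some L_i, and every L_i-formula arises this way.

module _ (L : Signature) where
  open Signature L

  data Term : Set
  data Formula : Set

  data Term where
    var  : ℕ → Term
    fun  : (f : Fun) → Vec Term (funArity f) → Term
    wAll : Formula → Term
    wEx  : Formula → Term

  data Formula where
    rel  : (r : Rel) → Vec Term (relArity r) → Formula
    neg  : Formula → Formula
    and  : Formula → Formula → Formula
    or   : Formula → Formula → Formula
    all  : Formula → Formula
    ex   : Formula → Formula

  -- L-Henkin sequent Γ ▹ Δ: pair of finite sets of formulas, represented
  -- by lists; lists with the same elements represent the same set
  -- (derivability is closed under this, see rule `set-eq` below).
  record Sequent : Set where
    constructor _▹_
    field
      ante : List Formula
      succ : List Formula

module _ {L : Signature} where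
  open Signature L

  mutual
    shiftT : ℕ → Term L → Term L
    shiftT c (var n) = if n <ᵇ c then var n else var (suc n)
    shiftT c (fun f ts) = fun f (shiftTs c ts)
    shiftT c (wAll φ) = wAll φ
    shiftT c (wEx φ) = wEx φ

    shiftTs : ∀ {n} → ℕ → Vec (Term L) n → Vec (Term L) n
    shiftTs c [] = []
    shiftTs c (t ∷ ts) = shiftT c t ∷ shiftTs c ts

  mutual
    substT : ℕ → Term L → Term L → Term L
    substT k u (var n) with compare n k
    ... | less _ _ = var n
    ... | equal _ = u
    ... | greater k′ m = var (k′ + m)
    substT k u (fun f ts) = fun f (substTs k u ts)
    substT k u (wAll φ) = wAll φ
    substT k u (wEx φ) = wEx φ

    substTs : ∀ {n} → ℕ → Term L → Vec (Term L) n → Vec (Term L) n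
    substTs k u [] = []
    substTs k u (t ∷ ts) = substT k u t ∷ substTs k u ts

  substF : ℕ → Term L → Formula L → Formula L
  substF k u (rel r ts) = rel r (substTs k u ts)
  substF k u (neg φ) = neg (substF k u φ)
  substF k u (and φ ψ) = and (substF k u φ) (substF k u ψ)
  substF k u (or φ ψ) = or (substF k u φ) (substF k u ψ)
  substF k u (all φ) = all (substF (suc k) (shiftT 0 u) φ)
  substF k u (ex φ) = ex (substF (suc k) (shiftT 0 u) φ)

  _[_] : Formula L → Term L → Formula L
  φ [ t ] = substF 0 t φ

  _≋_ : List (Formula L) → List (Formula L) → Set
  Γ ≋ Γ' = (Γ ⊆ Γ') × (Γ' ⊆ Γ)

  _⊔_ : Sequent L → Sequent L → Sequent L
  (Γ₁ ▹ Δ₁) ⊔ (Γ₂ ▹ Δ₂) = (Γ₁ ++ Γ₂) ▹ (Δ₁ ++ Δ₂)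

  _,,_ : (Sequent L → Set) → Sequent L → (Sequent L → Set)
  (X ,, S') S = X S ⊎ S ≡ S'

  -- X ⊢_{ST^H} S : finite derivations with leaves (ID) or members of X.
  -- "Γ ▹ Δ , φ" is written Γ ▹ (φ ∷ Δ); "φ , Γ" is φ ∷ Γ.
  data _⊢_ (X : Sequent L → Set) : Sequent L → Set where
    hyp    : ∀ {S} → X S → X ⊢ S
    ID     : ∀ φ → X ⊢ ((φ ∷ []) ▹ (φ ∷ []))
    set-eq : ∀ {Γ Δ Γ' Δ'} → Γ ≋ Γ' → Δ ≋ Δ' → X ⊢ (Γ ▹ Δ) → X ⊢ (Γ' ▹ Δ')
    WL     : ∀ {Γ Δ} φ → X ⊢ (Γ ▹ Δ) → X ⊢ ((φ ∷ Γ) ▹ Δ)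
    WR     : ∀ {Γ Δ} φ → X ⊢ (Γ ▹ Δ) → X ⊢ (Γ ▹ (φ ∷ Δ))
    -- bidirectional rules: top-down (↓) and bottom-up (↑)
    ∧L↓ : ∀ {Γ Δ φ ψ} → X ⊢ ((φ ∷ ψ ∷ Γ) ▹ Δ) → X ⊢ ((and φ ψ ∷ Γ) ▹ Δ)
    ∧L↑ : ∀ {Γ Δ φ ψ} → X ⊢ ((and φ ψ ∷ Γ) ▹ Δ) → X ⊢ ((φ ∷ ψ ∷ Γ) ▹ Δ)
    ∧R↓ : ∀ {Γ Δ φ ψ} → X ⊢ (Γ ▹ (φ ∷ Δ)) → X ⊢ (Γ ▹ (ψ ∷ Δ)) → X ⊢ (Γ ▹ (and φ ψ ∷ Δ))
    ∧R↑₁ : ∀ {Γ Δ φ ψ} → X ⊢ (Γ ▹ (and φ ψ ∷ Δ)) → X ⊢ (Γ ▹ (φ ∷ Δ))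
    ∧R↑₂ : ∀ {Γ Δ φ ψ} → X ⊢ (Γ ▹ (and φ ψ ∷ Δ)) → X ⊢ (Γ ▹ (ψ ∷ Δ))
    ∨L↓ : ∀ {Γ Δ φ ψ} → X ⊢ ((φ ∷ Γ) ▹ Δ) → X ⊢ ((ψ ∷ Γ) ▹ Δ) → X ⊢ ((or φ ψ ∷ Γ) ▹ Δ)
    ∨L↑₁ : ∀ {Γ Δ φ ψ} → X ⊢ ((or φ ψ ∷ Γ) ▹ Δ) → X ⊢ ((φ ∷ Γ) ▹ Δ)
    ∨L↑₂ : ∀ {Γ Δ φ ψ} → X ⊢ ((or φ ψ ∷ Γ) ▹ Δ) → X ⊢ ((ψ ∷ Γ) ▹ Δ)
    ∨R↓ : ∀ {Γ Δ φ ψ} → X ⊢ (Γ ▹ (φ ∷ ψ ∷ Δ)) → X ⊢ (Γ ▹ (or φ ψ ∷ Δ))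
    ∨R↑ : ∀ {Γ Δ φ ψ} → X ⊢ (Γ ▹ (or φ ψ ∷ Δ)) → X ⊢ (Γ ▹ (φ ∷ ψ ∷ Δ))
    ¬R↓ : ∀ {Γ Δ φ} → X ⊢ ((φ ∷ Γ) ▹ Δ) → X ⊢ (Γ ▹ (neg φ ∷ Δ))
    ¬R↑ : ∀ {Γ Δ φ} → X ⊢ (Γ ▹ (neg φ ∷ Δ)) → X ⊢ ((φ ∷ Γ) ▹ Δ)
    ¬L↓ : ∀ {Γ Δ φ} → X ⊢ (Γ ▹ (φ ∷ Δ)) → X ⊢ ((neg φ ∷ Γ) ▹ Δ)
    ¬L↑ : ∀ {Γ Δ φ} → X ⊢ ((neg φ ∷ Γ) ▹ Δ) → X ⊢ (Γ ▹ (φ ∷ Δ))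
    ∀LW↓ : ∀ {Γ Δ φ} → X ⊢ ((φ [ wAll φ ] ∷ Γ) ▹ Δ) → X ⊢ ((all φ ∷ Γ) ▹ Δ)
    ∀LW↑ : ∀ {Γ Δ φ} → X ⊢ ((all φ ∷ Γ) ▹ Δ) → X ⊢ ((φ [ wAll φ ] ∷ Γ) ▹ Δ)
    ∀RW↓ : ∀ {Γ Δ φ} → X ⊢ (Γ ▹ (φ [ wAll φ ] ∷ Δ)) → X ⊢ (Γ ▹ (all φ ∷ Δ))
    ∀RW↑ : ∀ {Γ Δ φ} → X ⊢ (Γ ▹ (all φ ∷ Δ)) → X ⊢ (Γ ▹ (φ [ wAll φ ] ∷ Δ))
    ∃LW↓ : ∀ {Γ Δ φ} → X ⊢ ((φ [ wEx φ ] ∷ Γ) ▹ Δ) → X ⊢ ((ex φ ∷ Γ) ▹ Δ)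
    ∃LW↑ : ∀ {Γ Δ φ} → X ⊢ ((ex φ ∷ Γ) ▹ Δ) → X ⊢ ((φ [ wEx φ ] ∷ Γ) ▹ Δ)
    ∃RW↓ : ∀ {Γ Δ φ} → X ⊢ (Γ ▹ (φ [ wEx φ ] ∷ Δ)) → X ⊢ (Γ ▹ (ex φ ∷ Δ))
    ∃RW↑ : ∀ {Γ Δ φ} → X ⊢ (Γ ▹ (ex φ ∷ Δ)) → X ⊢ (Γ ▹ (φ [ wEx φ ] ∷ Δ))
    UWI : ∀ {Γ Δ φ} t → X ⊢ ((φ [ t ] ∷ Γ) ▹ Δ) → X ⊢ ((φ [ wAll φ ] ∷ Γ) ▹ Δ)
    EWI : ∀ {Γ Δ φ} t → X ⊢ (Γ ▹ (φ [ t ] ∷ Δ)) → X ⊢ (Γ ▹ (φ [ wEx φ ] ∷ Δ))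
    EWE : ∀ {Γ Δ φ} t → X ⊢ ((φ [ wEx φ ] ∷ Γ) ▹ Δ) → X ⊢ ((φ [ t ] ∷ Γ) ▹ Δ)
    UWE : ∀ {Γ Δ φ} t → X ⊢ (Γ ▹ (φ [ wAll φ ] ∷ Δ)) → X ⊢ (Γ ▹ (φ [ t ] ∷ Δ))

-- Every rule of ST^H rewrites one principal formula and keeps its side contexts
-- arbitrary, so a derivation of T from leaves X can be replayed with a fixed
-- sequent C joined to every node: it becomes a derivation of T ⊔ C whose leaves
-- are the sequents S ⊔ C for S ∈ X. Since S₁ ⊔ S₂ weakens both S₁ and S₂, every
-- consequence of X, S₁ ⊔ S₂ is one of X, S₁ and of X, S₂. Conversely, joining S₂
-- to a derivation of S from X, S₁ gives S ⊔ S₂ from X, S₁ ⊔ S₂; joining S to a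
-- derivation of S from X, S₂ then turns its leaf S₂ into S₂ ⊔ S, which we just
-- derived, and yields S ⊔ S, i.e. S, because sequents are pairs of sets.
module Submission where

open import Defs
open import Data.Product using (_×_; _,_)
open import Data.Sum using (inj₁; inj₂; [_,_]′)
open import Function using (id; _∘_)
open import Function.Bundles using (_⇔_; mk⇔)
open import Data.List using (List; []; _∷_; _++_)
open import Data.List.Membership.Propositional.Properties using (∈-++⁻)
open import Data.List.Relation.Binary.Subset.Propositional.Properties
  using (⊆-reflexive-↭; xs⊆xs++ys; ++⁺ˡ)
open import Data.List.Relation.Binary.Permutation.Propositional using (_↭_; ↭-sym)
open import Data.List.Relation.Binary.Permutation.Propositional.Properties
  using (++-comm; ++-identityʳ)
open import Relation.Binary.PropositionalEquality using (refl)

module _ {L : Signature} where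

  open Sequent

  private variable
    X Y : Sequent L → Set
    Γ Γ' Δ Δ' : List (Formula L)
    S S' T : Sequent L

  ↭⇒≋ : Γ ↭ Γ' → Γ ≋ Γ'
  ↭⇒≋ p = ⊆-reflexive-↭ p , ⊆-reflexive-↭ (↭-sym p)

  ++⁺ˡ-≋ : ∀ Θ → Γ ≋ Γ' → (Γ ++ Θ) ≋ (Γ' ++ Θ)
  ++⁺ˡ-≋ Θ (Γ⊆Γ' , Γ'⊆Γ) = ++⁺ˡ Θ Γ⊆Γ' , ++⁺ˡ Θ Γ'⊆Γ

  ++-idem-≋ : (Γ : List (Formula L)) → (Γ ++ Γ) ≋ Γ
  ++-idem-≋ Γ = [ id , id ]′ ∘ ∈-++⁻ Γ , xs⊆xs++ys Γ Γ

  ⊢-resp-↭ : Γ ↭ Γ' → Δ ↭ Δ' → X ⊢ (Γ ▹ Δ) → X ⊢ (Γ' ▹ Δ')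
  ⊢-resp-↭ p q = set-eq (↭⇒≋ p) (↭⇒≋ q)

  ∅ : Sequent L
  ∅ = [] ▹ []

  ⊢-⊔-identityʳ : X ⊢ (S ⊔ ∅) → X ⊢ S
  ⊢-⊔-identityʳ {S = Γ ▹ Δ} = ⊢-resp-↭ (++-identityʳ Γ) (++-identityʳ Δ)

  ⊢-⊔-comm : ∀ S S' → X ⊢ (S ⊔ S') → X ⊢ (S' ⊔ S)
  ⊢-⊔-comm (Γ ▹ Δ) (Γ' ▹ Δ') = ⊢-resp-↭ (++-comm Γ Γ') (++-comm Δ Δ')

  ⊢-⊔-idem : X ⊢ (S ⊔ S) → X ⊢ S
  ⊢-⊔-idem {S = Γ ▹ Δ} = set-eq (++-idem-≋ Γ) (++-idem-≋ Δ)

  WL* : ∀ Θ → X ⊢ (Γ ▹ Δ) → X ⊢ ((Θ ++ Γ) ▹ Δ)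
  WL* []      d = d
  WL* (φ ∷ Θ) d = WL φ (WL* Θ d)

  WR* : ∀ Θ → X ⊢ (Γ ▹ Δ) → X ⊢ (Γ ▹ (Θ ++ Δ))
  WR* []      d = d
  WR* (φ ∷ Θ) d = WR φ (WR* Θ d)

  ⊢-⊔-weaken : ∀ C → X ⊢ S → X ⊢ (S ⊔ C)
  ⊢-⊔-weaken {S = S} C d = ⊢-⊔-comm C S (WR* (succ C) (WL* (ante C) d))

  ⊢-bind-⊔ : ∀ C → (∀ {S} → X S → Y ⊢ (S ⊔ C)) → X ⊢ T → Y ⊢ (T ⊔ C)
  ⊢-bind-⊔ C h (hyp x)          = h x
  ⊢-bind-⊔ C h (ID φ)           = ⊢-⊔-weaken C (ID φ)
  ⊢-bind-⊔ C h (set-eq Γ≋ Δ≋ d) = set-eq (++⁺ˡ-≋ (ante C) Γ≋) (++⁺ˡ-≋ (succ C) Δ≋) (⊢-bind-⊔ C h d)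
  ⊢-bind-⊔ C h (WL φ d)         = WL φ (⊢-bind-⊔ C h d)
  ⊢-bind-⊔ C h (WR φ d)         = WR φ (⊢-bind-⊔ C h d)
  ⊢-bind-⊔ C h (∧L↓ d)          = ∧L↓ (⊢-bind-⊔ C h d)
  ⊢-bind-⊔ C h (∧L↑ d)          = ∧L↑ (⊢-bind-⊔ C h d)
  ⊢-bind-⊔ C h (∧R↓ d e)        = ∧R↓ (⊢-bind-⊔ C h d) (⊢-bind-⊔ C h e)
  ⊢-bind-⊔ C h (∧R↑₁ d)         = ∧R↑₁ (⊢-bind-⊔ C h d)
  ⊢-bind-⊔ C h (∧R↑₂ d)         = ∧R↑₂ (⊢-bind-⊔ C h d)
  ⊢-bind-⊔ C h (∨L↓ d e)        = ∨L↓ (⊢-bind-⊔ C h d) (⊢-bind-⊔ C h e)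
  ⊢-bind-⊔ C h (∨L↑₁ d)         = ∨L↑₁ (⊢-bind-⊔ C h d)
  ⊢-bind-⊔ C h (∨L↑₂ d)         = ∨L↑₂ (⊢-bind-⊔ C h d)
  ⊢-bind-⊔ C h (∨R↓ d)          = ∨R↓ (⊢-bind-⊔ C h d)
  ⊢-bind-⊔ C h (∨R↑ d)          = ∨R↑ (⊢-bind-⊔ C h d)
  ⊢-bind-⊔ C h (¬R↓ d)          = ¬R↓ (⊢-bind-⊔ C h d)
  ⊢-bind-⊔ C h (¬R↑ d)          = ¬R↑ (⊢-bind-⊔ C h d)
  ⊢-bind-⊔ C h (¬L↓ d)          = ¬L↓ (⊢-bind-⊔ C h d)
  ⊢-bind-⊔ C h (¬L↑ d)          = ¬L↑ (⊢-bind-⊔ C h d)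
  ⊢-bind-⊔ C h (∀LW↓ d)         = ∀LW↓ (⊢-bind-⊔ C h d)
  ⊢-bind-⊔ C h (∀LW↑ d)         = ∀LW↑ (⊢-bind-⊔ C h d)
  ⊢-bind-⊔ C h (∀RW↓ d)         = ∀RW↓ (⊢-bind-⊔ C h d)
  ⊢-bind-⊔ C h (∀RW↑ d)         = ∀RW↑ (⊢-bind-⊔ C h d)
  ⊢-bind-⊔ C h (∃LW↓ d)         = ∃LW↓ (⊢-bind-⊔ C h d)
  ⊢-bind-⊔ C h (∃LW↑ d)         = ∃LW↑ (⊢-bind-⊔ C h d)
  ⊢-bind-⊔ C h (∃RW↓ d)         = ∃RW↓ (⊢-bind-⊔ C h d)
  ⊢-bind-⊔ C h (∃RW↑ d)         = ∃RW↑ (⊢-bind-⊔ C h d)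
  ⊢-bind-⊔ C h (UWI t d)        = UWI t (⊢-bind-⊔ C h d)
  ⊢-bind-⊔ C h (EWI t d)        = EWI t (⊢-bind-⊔ C h d)
  ⊢-bind-⊔ C h (EWE t d)        = EWE t (⊢-bind-⊔ C h d)
  ⊢-bind-⊔ C h (UWE t d)        = UWE t (⊢-bind-⊔ C h d)

  ⊢-bind : (∀ {S} → X S → Y ⊢ S) → X ⊢ T → Y ⊢ T
  ⊢-bind h = ⊢-⊔-identityʳ ∘ ⊢-bind-⊔ ∅ (⊢-⊔-weaken ∅ ∘ h)

  ⊢-,,-graft : (X ,, S') ⊢ S → (X ,, S) ⊢ T → (X ,, S') ⊢ T
  ⊢-,,-graft d = ⊢-bind λ { (inj₁ x) → hyp (inj₁ x) ; (inj₂ refl) → d }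

  ⊢-,,-graft-⊔ : ∀ C → (X ,, S') ⊢ (S ⊔ C) → (X ,, S) ⊢ T → (X ,, S') ⊢ (T ⊔ C)
  ⊢-,,-graft-⊔ C d = ⊢-bind-⊔ C λ
    { (inj₁ x) → ⊢-⊔-weaken C (hyp (inj₁ x)) ; (inj₂ refl) → d }

mainTheorem4 : (L : Signature) (X : Sequent L → Set) (S₁ S₂ : Sequent L) →
    ∀ (S : Sequent L) → ((X ,, (S₁ ⊔ S₂)) ⊢ S) ⇔ (((X ,, S₁) ⊢ S) × ((X ,, S₂) ⊢ S))
mainTheorem4 L X S₁ S₂ S = mk⇔
  (λ d → ⊢-,,-graft S₁⊔S₂-from-S₁ d , ⊢-,,-graft S₁⊔S₂-from-S₂ d)
  (λ (d₁ , d₂) → ⊢-⊔-idem (⊢-,,-graft-⊔ S (⊢-⊔-comm S S₂ (S⊔S₂-from-S₁⊔S₂ d₁)) d₂))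
  where
    leaf : ∀ {T} → (X ,, T) ⊢ T
    leaf = hyp (inj₂ refl)

    S₁⊔S₂-from-S₁ : (X ,, S₁) ⊢ (S₁ ⊔ S₂)
    S₁⊔S₂-from-S₁ = ⊢-⊔-weaken S₂ leaf

    S₁⊔S₂-from-S₂ : (X ,, S₂) ⊢ (S₁ ⊔ S₂)
    S₁⊔S₂-from-S₂ = ⊢-⊔-comm S₂ S₁ (⊢-⊔-weaken S₁ leaf)

    S⊔S₂-from-S₁⊔S₂ : (X ,, S₁) ⊢ S → (X ,, (S₁ ⊔ S₂)) ⊢ (S ⊔ S₂)
    S⊔S₂-from-S₁⊔S₂ = ⊢-,,-graft-⊔ S₂ leaf
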